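{- Let $g\ge1$, $t\ge1$, $k\ge0$. Every O-tree $(T,\sigma)\in\mathcal{R}_{g,t,k}$ has exactly $2g+t-k-1$ permissible sectors.
   Context: A plane tree is a rooted plane tree whose root vertex carries an extra plant edge; the degree of a vertex counts the plant edge at the root. For a vertex $v$ with children $c_1,\dots,c_r$ (left to right), the sectors around $v$ are, in order: between the parent edge (or the plant edge if $v$ is the root) and $c_1$, between $c_1$ and $c_2$, ..., between $c_r$ and the parent/plant edge; so $v$ has $r+1$ sectors (a leaf has one), ordered first to last in this way (the order in which a contour traversal starting from the plant edge visits them). Vertices of a tree with $m$ edges are numbered $1,\dots,m+1$ in left-to-right depth-first preorder. An O-permutation is a permutation with all cycles of odd length. An O-tree is a pair $(T,\sigma)$, $T$ a plane tree with $m$ edges and $\sigma$ an O-permutation of its vertices; $G(T,\sigma)$ is the multigraph obtained by merging the vertices of each cycle of $\sigma$ into one vertex (degrees add). A vertex $v$ of $T$ is a $1$-cycle if $\sigma(v)=v$. $\mathcal{R}_{g,t,k}$ is the set of O-trees with $T$ having $2g+t+k-1$ edges, $\sigma$ having exactly $k$ fixed points and exactly $t$ cycles of length $>1$, and every vertex of $G(T,\sigma)$ of degree $\ge3$. A sector $\tau$ at a vertex $v$ of $(T,\sigma)$ is permissible if $\tau$ is not the last sector around $v$, and, in case $v$ is a $1$-cycle, $\tau$ is not one of the first two sectors around $v$. -}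

module Defs where

open import Data.Nat using (ℕ; zero; suc; _+_; _*_; _∸_; _≤_; _<_; _%_; _≟_; _≤?_; _<?_)
open import Data.Fin using (Fin; toℕ)
import Data.Fin as Fin
open import Data.Fin.Permutation using (Permutation′; _⟨$⟩ʳ_)
open import Data.List using (List; []; _∷_; _++_; length; map; filter; upTo; allFin)
open import Data.Nat.ListAction using (sum)
open import Data.List.Relation.Unary.All using (All; all?)
open import Data.Product using (_×_)
open import Relation.Binary.PropositionalEquality using (_≡_)
open import Relation.Nullary using (¬_; Dec; yes; no)
open import Relation.Nullary.Decidable using (_×-dec_; _→-dec_)

-- Plane trees: rooted, ordered (the root carries an implicit plant edge).

data PlaneTree : Set where
  node : List PlaneTree → PlaneTree

-- Number of children of each vertex, listed in left-to-right
-- depth-first preorder (so position i is vertex i+1 of the paper).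
mutual
  childCounts : PlaneTree → List ℕ
  childCounts (node ts) = length ts ∷ childCountsL ts

  childCountsL : List PlaneTree → List ℕ
  childCountsL [] = []
  childCountsL (t ∷ ts) = childCounts t ++ childCountsL ts

nV : PlaneTree → ℕ
nV T = length (childCounts T)

edges : PlaneTree → ℕ
edges T = nV T ∸ 1

Vertex : PlaneTree → Set
Vertex T = Fin (nV T)

children : (T : PlaneTree) → Vertex T → ℕ
children T v = Data.List.lookup (childCounts T) v

-- degree in T: children plus the parent edge (or plant edge at the root)
degree : (T : PlaneTree) → Vertex T → ℕ
degree T v = suc (children T v)

module _ {n : ℕ} (σ : Permutation′ n) where

  iter : ℕ → Fin n → Fin n
  iter zero v = v
  iter (suc j) v = σ ⟨$⟩ʳ iter j v

  returnTimes : Fin n → List ℕ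
  returnTimes v = filter (λ j → iter j v Fin.≟ v) (map suc (upTo n))

  cycleLen : Fin n → ℕ
  cycleLen v with returnTimes v
  ... | [] = 0
  ... | j ∷ _ = j

  IsOPerm : Set
  IsOPerm = ∀ v → cycleLen v % 2 ≡ 1

  isFixed? : (v : Fin n) → Dec (σ ⟨$⟩ʳ v ≡ v)
  isFixed? v = σ ⟨$⟩ʳ v Fin.≟ v

  numFixed : ℕ
  numFixed = length (filter isFixed? (allFin n))

  isCycleMin? : (v : Fin n) → Dec (All (λ j → toℕ v ≤ toℕ (iter j v)) (upTo n))
  isCycleMin? v = all? (λ j → toℕ v ≤? toℕ (iter j v)) (upTo n)

  numLongCycles : ℕ
  numLongCycles =
    length (filter (λ v → (1 <? cycleLen v) ×-dec isCycleMin? v) (allFin n))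

-- degree in G(T,σ) of the merged vertex corresponding to the cycle of v
gDegree : (T : PlaneTree) (σ : Permutation′ (nV T)) → Vertex T → ℕ
gDegree T σ v = sum (map (λ j → degree T (iter σ j v)) (upTo (cycleLen σ v)))

AllGDegreeAtLeast3 : (T : PlaneTree) (σ : Permutation′ (nV T)) → Set
AllGDegreeAtLeast3 T σ = ∀ v → 3 ≤ gDegree T σ v

InR : (g t k : ℕ) (T : PlaneTree) (σ : Permutation′ (nV T)) → Set
InR g t k T σ =
  edges T ≡ 2 * g + t + k ∸ 1 ×
  IsOPerm σ ×
  numFixed σ ≡ k ×
  numLongCycles σ ≡ t ×
  AllGDegreeAtLeast3 T σ

-- Vertex v has (children v + 1) sectors, indexed 0,…,children v
-- from first to last.

Permissible : (T : PlaneTree) (σ : Permutation′ (nV T)) → Vertex T → ℕ → Set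
Permissible T σ v i = (i < children T v) × (σ ⟨$⟩ʳ v ≡ v → 2 ≤ i)

permissible? : (T : PlaneTree) (σ : Permutation′ (nV T)) (v : Vertex T) (i : ℕ) →
               Dec (Permissible T σ v i)
permissible? T σ v i = (i <? children T v) ×-dec (isFixed? σ v →-dec (2 ≤? i))

sectors : (T : PlaneTree) → Vertex T → List ℕ
sectors T v = upTo (suc (children T v))

numPermissibleAt : (T : PlaneTree) (σ : Permutation′ (nV T)) → Vertex T → ℕ
numPermissibleAt T σ v = length (filter (permissible? T σ v) (sectors T v))

numPermissible : (T : PlaneTree) (σ : Permutation′ (nV T)) → ℕ
numPermissible T σ = sum (map (numPermissibleAt T σ) (allFin (nV T)))

-- So a non-fixed vertex contributes c
-- permissible sectors and a fixed one c − 2; the latter is not truncated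
-- because a fixed point is a vertex of G(T,σ) on its own, so its degree c + 1
-- is at least 3. Summing, the count is (number of edges) − 2k
-- = (2g + t + k − 1) − 2k.
module Submission where

open import Defs
open import Data.Nat using (ℕ; zero; suc; _+_; _*_; _∸_; _≤_; _<_; z≤n; s≤s; s≤s⁻¹)
open import Data.Nat.Properties
  using (0∸n≡0; +-identityʳ; +-assoc; +-comm; +-cancelʳ-≡; +-∸-comm; ∸-+-assoc; m+n∸n≡m; m∸n+n≡m; n≤1+n; *-zeroʳ)
open import Data.Nat.Tactic.RingSolver using (solve-∀)
import Data.Fin as Fin
open import Data.Fin.Permutation using (Permutation′; _⟨$⟩ʳ_)
open import Data.List using ([]; _∷_; _++_; length; map; filter; applyUpTo; upTo; tabulate; allFin; lookup)
open import Data.List.Properties using (filter-accept; filter-reject; length-++; map-tabulate; tabulate-lookup)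
open import Data.Nat.ListAction using (sum)
open import Data.Nat.ListAction.Properties using (sum-++)
open import Data.Product using (_×_; _,_; proj₁; proj₂)
open import Relation.Nullary using (¬_; yes; no)
open import Relation.Unary using (Pred; Decidable)
open import Relation.Binary.PropositionalEquality using (_≡_; refl; sym; trans; cong; cong₂; subst; module ≡-Reasoning)
open import Data.Empty using (⊥-elim)

open ≡-Reasoning

mutual
  suc-sum-childCounts : ∀ T → suc (sum (childCounts T)) ≡ nV T
  suc-sum-childCounts (node ts) = cong suc (length+sum-childCountsL ts)

  length+sum-childCountsL : ∀ ts → length ts + sum (childCountsL ts) ≡ length (childCountsL ts)
  length+sum-childCountsL [] = refl
  length+sum-childCountsL (t ∷ ts) = begin
    suc (length ts) + sum (childCounts t ++ childCountsL ts)
      ≡⟨ cong (suc (length ts) +_) (sum-++ (childCounts t) (childCountsL ts)) ⟩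
    suc (length ts) + (sum (childCounts t) + sum (childCountsL ts))
      ≡⟨ exchange (length ts) (sum (childCounts t)) (sum (childCountsL ts)) ⟩
    suc (sum (childCounts t)) + (length ts + sum (childCountsL ts))
      ≡⟨ cong₂ _+_ (suc-sum-childCounts t) (length+sum-childCountsL ts) ⟩
    nV t + length (childCountsL ts)
      ≡⟨ sym (length-++ (childCounts t)) ⟩
    length (childCounts t ++ childCountsL ts) ∎
    where
    exchange : ∀ a b c → suc a + (b + c) ≡ suc b + (a + c)
    exchange = solve-∀

sum-children≡edges : ∀ T → sum (map (children T) (allFin (nV T))) ≡ edges T
sum-children≡edges T = begin
  sum (map (lookup (childCounts T)) (allFin (nV T)))
    ≡⟨ cong sum (map-tabulate (λ v → v) (lookup (childCounts T))) ⟩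
  sum (tabulate (lookup (childCounts T)))
    ≡⟨ cong sum (tabulate-lookup (childCounts T)) ⟩
  sum (childCounts T)
    ≡⟨ cong (_∸ 1) (suc-sum-childCounts T) ⟩
  edges T ∎

length-filter-applyUpTo-interval :
  ∀ {a} {A : Set a} {p} {P : Pred A p} (P? : Decidable P) (f : ℕ → A) {lo hi} n → hi ≤ n →
  (∀ i → lo ≤ i → i < hi → P (f i)) → (∀ i → P (f i) → lo ≤ i × i < hi) →
  length (filter P? (applyUpTo f n)) ≡ hi ∸ lo
length-filter-applyUpTo-interval P? f {lo} zero z≤n _ _ = sym (0∸n≡0 lo)
length-filter-applyUpTo-interval P? f {lo} {zero} (suc n) _ _ inside = begin
  length (filter P? (applyUpTo f (suc n)))
    ≡⟨ cong length (filter-reject P? (λ p → outside (proj₂ (inside 0 p)))) ⟩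
  length (filter P? (applyUpTo (λ i → f (suc i)) n))
    ≡⟨ length-filter-applyUpTo-interval P? (λ i → f (suc i)) {lo} n z≤n (λ _ _ ())
         (λ i p → ⊥-elim (outside (proj₂ (inside (suc i) p)))) ⟩
  zero ∸ lo ∎
  where
  outside : ∀ {i} → ¬ i < zero
  outside ()
length-filter-applyUpTo-interval P? f {zero} {suc hi} (suc n) (s≤s hi≤n) holds inside =
  trans (cong length (filter-accept P? (holds 0 z≤n (s≤s z≤n))))
        (cong suc (length-filter-applyUpTo-interval P? (λ i → f (suc i)) n hi≤n
          (λ i _ i<hi → holds (suc i) z≤n (s≤s i<hi))
          (λ i p → z≤n , s≤s⁻¹ (proj₂ (inside (suc i) p)))))
length-filter-applyUpTo-interval P? f {suc lo} {suc hi} (suc n) (s≤s hi≤n) holds inside =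
  trans (cong length (filter-reject P? (λ p → below (proj₁ (inside 0 p)))))
        (length-filter-applyUpTo-interval P? (λ i → f (suc i)) n hi≤n
          (λ i lo≤i i<hi → holds (suc i) (s≤s lo≤i) (s≤s i<hi))
          (λ i p → let lo≤i , i<hi = inside (suc i) p in s≤s⁻¹ lo≤i , s≤s⁻¹ i<hi))
  where
  below : ¬ suc lo ≤ zero
  below ()

cycleLen-head : ∀ {n} (σ : Permutation′ n) v {j js} → returnTimes σ v ≡ j ∷ js → cycleLen σ v ≡ j
cycleLen-head σ v eq with returnTimes σ v | eq
... | _ | refl = refl

cycleLen-fixed : ∀ {n} (σ : Permutation′ n) v → σ ⟨$⟩ʳ v ≡ v → cycleLen σ v ≡ 1
cycleLen-fixed {suc n} σ v fixed =
  cycleLen-head σ v (filter-accept (λ j → iter σ j v Fin.≟ v) fixed)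

2≤children-fixed : ∀ T σ v → AllGDegreeAtLeast3 T σ → σ ⟨$⟩ʳ v ≡ v → 2 ≤ children T v
2≤children-fixed T σ v gdeg fixed = subst (2 ≤_) (+-identityʳ (children T v)) (s≤s⁻¹ 3≤deg+0)
  where
  3≤deg+0 : 3 ≤ degree T v + 0
  3≤deg+0 = subst (λ l → 3 ≤ sum (map (λ j → degree T (iter σ j v)) (upTo l)))
                  (cycleLen-fixed σ v fixed) (gdeg v)

numPermissibleAt-nonFixed : ∀ T σ v → ¬ σ ⟨$⟩ʳ v ≡ v → numPermissibleAt T σ v ≡ children T v
numPermissibleAt-nonFixed T σ v nonFixed =
  length-filter-applyUpTo-interval (permissible? T σ v) (λ i → i) (suc (children T v)) (n≤1+n _)
    (λ i _ i<c → i<c , λ fixed → ⊥-elim (nonFixed fixed))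
    (λ i p → z≤n , proj₁ p)

numPermissibleAt-fixed : ∀ T σ v → σ ⟨$⟩ʳ v ≡ v → numPermissibleAt T σ v ≡ children T v ∸ 2
numPermissibleAt-fixed T σ v fixed =
  length-filter-applyUpTo-interval (permissible? T σ v) (λ i → i) (suc (children T v)) (n≤1+n _)
    (λ i 2≤i i<c → i<c , λ _ → 2≤i)
    (λ i p → proj₂ p fixed , proj₁ p)

sum-map-+-*-length-filter :
  ∀ {a} {A : Set a} {p} {P : Pred A p} (P? : Decidable P) (f h : A → ℕ) d →
  (∀ x → P x → f x + d ≡ h x) → (∀ x → ¬ P x → f x ≡ h x) →
  ∀ xs → sum (map f xs) + d * length (filter P? xs) ≡ sum (map h xs)
sum-map-+-*-length-filter P? f h d onP offP [] = *-zeroʳ d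
sum-map-+-*-length-filter P? f h d onP offP (x ∷ xs) with P? x
... | yes px = begin
  f x + sum (map f xs) + d * suc (length (filter P? xs))
    ≡⟨ regroup (f x) (sum (map f xs)) d (length (filter P? xs)) ⟩
  (f x + d) + (sum (map f xs) + d * length (filter P? xs))
    ≡⟨ cong₂ _+_ (onP x px) (sum-map-+-*-length-filter P? f h d onP offP xs) ⟩
  h x + sum (map h xs) ∎
  where
  regroup : ∀ a b c l → a + b + c * suc l ≡ (a + c) + (b + c * l)
  regroup = solve-∀
... | no ¬px = begin
  f x + sum (map f xs) + d * length (filter P? xs)
    ≡⟨ +-assoc (f x) _ _ ⟩
  f x + (sum (map f xs) + d * length (filter P? xs))
    ≡⟨ cong₂ _+_ (offP x ¬px) (sum-map-+-*-length-filter P? f h d onP offP xs) ⟩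
  h x + sum (map h xs) ∎

numPermissible+2*numFixed≡edges :
  ∀ T σ → AllGDegreeAtLeast3 T σ → numPermissible T σ + 2 * numFixed σ ≡ edges T
numPermissible+2*numFixed≡edges T σ gdeg =
  trans (sum-map-+-*-length-filter (isFixed? σ) (numPermissibleAt T σ) (children T) 2
          (λ v fixed → trans (cong (_+ 2) (numPermissibleAt-fixed T σ v fixed))
                             (m∸n+n≡m (2≤children-fixed T σ v gdeg fixed)))
          (numPermissibleAt-nonFixed T σ) (allFin (nV T)))
        (sum-children≡edges T)

x+2*k≡m+k∸1⇒x≡m∸k∸1 : ∀ m k x → 1 ≤ m → x + 2 * k ≡ m + k ∸ 1 → x ≡ m ∸ k ∸ 1
x+2*k≡m+k∸1⇒x≡m∸k∸1 m k x 1≤m eq = begin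
  x                 ≡⟨ sym (m+n∸n≡m x k) ⟩
  x + k ∸ k         ≡⟨ cong (_∸ k) x+k≡m∸1 ⟩
  m ∸ 1 ∸ k         ≡⟨ ∸-+-assoc m 1 k ⟩
  m ∸ (1 + k)       ≡⟨ cong (m ∸_) (+-comm 1 k) ⟩
  m ∸ (k + 1)       ≡⟨ sym (∸-+-assoc m k 1) ⟩
  m ∸ k ∸ 1 ∎
  where
  x+k≡m∸1 : x + k ≡ m ∸ 1
  x+k≡m∸1 = +-cancelʳ-≡ k (x + k) (m ∸ 1) (begin
    x + k + k       ≡⟨ +-assoc x k k ⟩
    x + (k + k)     ≡⟨ cong (λ y → x + (k + y)) (sym (+-identityʳ k)) ⟩
    x + 2 * k       ≡⟨ eq ⟩
    m + k ∸ 1       ≡⟨ +-∸-comm k 1≤m ⟩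
    m ∸ 1 + k ∎)

proposition5 : (g t k : ℕ) → 1 ≤ g → 1 ≤ t →
    (T : PlaneTree) (σ : Permutation′ (nV T)) → InR g t k T σ →
    numPermissible T σ ≡ 2 * g + t ∸ k ∸ 1
proposition5 (suc g) t k _ _ T σ (#edges , _ , #fixed , _ , gdeg) =
  x+2*k≡m+k∸1⇒x≡m∸k∸1 (2 * suc g + t) k (numPermissible T σ) (s≤s z≤n) (begin
    numPermissible T σ + 2 * k            ≡⟨ cong (λ f → numPermissible T σ + 2 * f) (sym #fixed) ⟩
    numPermissible T σ + 2 * numFixed σ   ≡⟨ numPermissible+2*numFixed≡edges T σ gdeg ⟩
    edges T                               ≡⟨ #edges ⟩
    2 * suc g + t + k ∸ 1 ∎)
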